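{- Let $\mathbb{L}$ be a layer system and let $\mathcal{R}$ be a TRS that is weakly layered according to $\mathbb{L}$. If $s\to_{\mathcal{R}}t$ for terms $s,t\in\mathcal{T}(\mathcal{F},\mathcal{V})$, then $\mathrm{rank}(s)\geq\mathrm{rank}(t)$.
   Context: Let $\mathcal{F}$ be a signature and $\mathcal{V}$ a countably infinite set of variables. $\square\notin\mathcal{F}\cup\mathcal{V}$ is a fresh constant (the hole). Contexts are the elements of $\mathcal{C}(\mathcal{F},\mathcal{V})=\mathcal{T}(\mathcal{F}\cup\{\square\},\mathcal{V})$. $\sqsubseteq$ is the smallest reflexive, transitive, monotone relation on contexts with $\square\sqsubseteq C$ for all $C$. $C\sqcup D$ is the least upper bound, when it exists. $\mathrm{Pos}_{\mathcal{F}}(C)$ is the set of positions of $C$ carrying a symbol of $\mathcal{F}$. Rules $\ell\to r$ satisfy $\ell\notin\mathcal{V}$ and $\mathrm{Var}(r)\subseteq\mathrm{Var}(\ell)$. Rewriting is extended to contexts by treating $\square$ as a constant. $s\to_{p,\ell\to r}t$ denotes a step at position $p$ with rule $\ell\to r$. Given $\mathbb{L}\subseteq\mathcal{C}(\mathcal{F},\mathcal{V})$, a top of $C$ is an $L\in\mathbb{L}$ with $L\sqsubseteq C$. A max-top is a $\sqsubseteq$-maximal top. $\mathbb{L}$ is a layer system if: (L1) every term in $\mathcal{T}(\mathcal{F},\mathcal{V})$ has a top other than $\square$; (L2) for $x\in\mathcal{V}$: $C[x]_p\in\mathbb{L}$ iff $C[\square]_p\in\mathbb{L}$; (L3) if $L,N\in\mathbb{L}$,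 $p\in\mathrm{Pos}_{\mathcal{F}}(L)$ and $L|_p\sqcup N$ is defined, then $L[L|_p\sqcup N]_p\in\mathbb{L}$. In a layer system every term has a unique max-top. For a term $t$, write $t=M[t_1,\dots,t_n]$ with $M$ the max-top of $t$ (filling its holes from left to right). The terms $t_1,\dots,t_n$ are the aliens of $t$, and $\mathrm{rank}(t)=1+\max\{\mathrm{rank}(t_i)\mid 1\leq i\leq n\}$, where $\max\varnothing=0$. $\mathcal{R}$ is weakly layered according to $\mathbb{L}$ if for every rule $\ell\to r\in\mathcal{R}$: (W) whenever $M$ is a max-top of a term $s$, $p\in\mathrm{Pos}_{\mathcal{F}}(M)$ and $s\to_{p,\ell\to r}t$, then $M\to_{p,\ell\to r}L$ for some $L\in\mathbb{L}$. -}

module Defs where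

open import Data.Nat using (ℕ; suc; _⊔_)
open import Data.Fin using (Fin; toℕ)
open import Data.Vec using (Vec; []; _∷_; lookup; _[_]≔_)
open import Data.List using (List; []; _∷_; _++_; foldr)
open import Data.List.Relation.Binary.Pointwise using (Pointwise)
open import Data.Product using (Σ; ∃; _×_)
open import Relation.Binary.PropositionalEquality using (_≡_; _≢_)
open import Relation.Nullary using (¬_)
open import Function.Bundles using (_⇔_)

record Signature : Set₁ where
  field
    Sym   : Set
    arity : Sym → ℕ

-- Positions: lists of argument indices (0-based).
Position : Set
Position = List ℕ

module _ (S : Signature) where
  open Signature S

  -- Contexts C(F,V) = T(F ∪ {□}, V); variables V = ℕ (countably infinite).
  data Ctx : Set where
    □   : Ctx
    var : ℕ → Ctx
    fun : (f : Sym) → Vec Ctx (arity f) → Ctx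

  -- Subterm C p D : C|_p = D
  data Subterm : Ctx → Position → Ctx → Set where
    here  : ∀ {C} → Subterm C [] C
    there : ∀ {f ts p D} (i : Fin (arity f)) →
            Subterm (lookup ts i) p D → Subterm (fun f ts) (toℕ i ∷ p) D

  -- Replace C p D E : p ∈ Pos(C) and E = C[D]_p
  data Replace : Ctx → Position → Ctx → Ctx → Set where
    here  : ∀ {C D} → Replace C [] D D
    there : ∀ {f ts p D E} (i : Fin (arity f)) →
            Replace (lookup ts i) p D E →
            Replace (fun f ts) (toℕ i ∷ p) D (fun f (ts [ i ]≔ E))

  PosF : Ctx → Position → Set
  PosF C p = ∃ λ f → ∃ λ (ts : Vec Ctx (arity f)) → Subterm C p (fun f ts)

  IsTerm : Ctx → Set
  IsTerm C = ¬ (∃ λ p → Subterm C p □)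

  _∈Vars_ : ℕ → Ctx → Set
  x ∈Vars C = ∃ λ p → Subterm C p (var x)

  -- substitution application (□ treated as a constant)
  mutual
    _⟨_⟩ : Ctx → (ℕ → Ctx) → Ctx
    □ ⟨ σ ⟩ = □
    var x ⟨ σ ⟩ = σ x
    fun f ts ⟨ σ ⟩ = fun f (substV ts σ)

    substV : ∀ {n} → Vec Ctx n → (ℕ → Ctx) → Vec Ctx n
    substV [] σ = []
    substV (t ∷ ts) σ = (t ⟨ σ ⟩) ∷ substV ts σ

  data _⊑_ : Ctx → Ctx → Set where
    ⊑-hole  : ∀ {C} → □ ⊑ C
    ⊑-refl  : ∀ {C} → C ⊑ C
    ⊑-trans : ∀ {C D E} → C ⊑ D → D ⊑ E → C ⊑ E
    ⊑-mono  : ∀ {f ts D} (i : Fin (arity f)) →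
              lookup ts i ⊑ D → fun f ts ⊑ fun f (ts [ i ]≔ D)

  IsLub : Ctx → Ctx → Ctx → Set
  IsLub C D E = C ⊑ E × D ⊑ E × (∀ U → C ⊑ U → D ⊑ U → E ⊑ U)

  IsRule : Ctx → Ctx → Set
  IsRule ℓ r = IsTerm ℓ × IsTerm r × (∀ x → ℓ ≢ var x) × (∀ x → x ∈Vars r → x ∈Vars ℓ)

  IsTRS : (Ctx → Ctx → Set) → Set
  IsTRS R = ∀ ℓ r → R ℓ r → IsRule ℓ r

  StepAt : Ctx → Position → Ctx → Ctx → Ctx → Set
  StepAt s p ℓ r t = ∃ λ (σ : ℕ → Ctx) → Subterm s p (ℓ ⟨ σ ⟩) × Replace s p (r ⟨ σ ⟩) t

  Rewrites : (Ctx → Ctx → Set) → Ctx → Ctx → Set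
  Rewrites R s t = ∃ λ p → ∃ λ ℓ → ∃ λ r → R ℓ r × StepAt s p ℓ r t

  module _ (𝕃 : Ctx → Set) where

    IsTop : Ctx → Ctx → Set
    IsTop L C = 𝕃 L × L ⊑ C

    IsMaxTop : Ctx → Ctx → Set
    IsMaxTop M C = IsTop M C × (∀ N → IsTop N C → M ⊑ N → N ≡ M)

    L1 : Set
    L1 = ∀ t → IsTerm t → ∃ λ L → IsTop L t × L ≢ □

    L2 : Set
    L2 = ∀ C p x E₁ E₂ → Replace C p (var x) E₁ → Replace C p □ E₂ → (𝕃 E₁ ⇔ 𝕃 E₂)

    L3 : Set
    L3 = ∀ L N p Lp E L′ → 𝕃 L → 𝕃 N → PosF L p → Subterm L p Lp →
         IsLub Lp N E → Replace L p E L′ → 𝕃 L′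

    IsLayerSystem : Set
    IsLayerSystem = L1 × L2 × L3

    -- Fill M us t : t = M[u₁,…,uₙ] (holes filled left to right)
    mutual
      data Fill : Ctx → List Ctx → Ctx → Set where
        hole : ∀ {t} → Fill □ (t ∷ []) t
        var  : ∀ {x} → Fill (var x) [] (var x)
        fun  : ∀ {f Ms us ts} → FillV {arity f} Ms us ts → Fill (fun f Ms) us (fun f ts)

      data FillV : ∀ {n} → Vec Ctx n → List Ctx → Vec Ctx n → Set where
        []  : FillV [] [] []
        _∷_ : ∀ {n M Ms us vs t} {ts : Vec Ctx n} →
              Fill M us t → FillV Ms vs ts → FillV (M ∷ Ms) (us ++ vs) (t ∷ ts)

    maxList : List ℕ → ℕ
    maxList = foldr _⊔_ 0

    -- HasRank t n : rank(t) = n, where rank(t) = 1 + max of ranks of the aliens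
    data HasRank : Ctx → ℕ → Set where
      rank : ∀ {t M ts ns} → IsMaxTop M t → Fill M ts t →
             Pointwise HasRank ts ns → HasRank t (suc (maxList ns))

    WeaklyLayered : (Ctx → Ctx → Set) → Set
    WeaklyLayered R = ∀ ℓ r → R ℓ r → ∀ s M p t → IsTerm s → IsMaxTop M s →
                      PosF M p → StepAt s p ℓ r t →
                      ∃ λ L → 𝕃 L × StepAt M p ℓ r L

module Submission where

-- Rank does not increase under weakly layered rewriting (only (L3) is used).
--
-- 'Prefix P M t' states M ⊑ t with every hole of M filled in t by a P-term;
-- t = M[t₁,…,tₙ] with M its max-top gives 'Prefix (_∈ aliens) M t'.  Module Descent: if s = M[s₁,…,sₙ] and s → t, then t is a
-- layer over the sᵢ and possibly one rewritten sᵢ — M itself for a step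
-- inside an alien (by induction), the layer given by (W) for a step in M.
-- So the aliens of t have rank ≤ max rank(sᵢ), i.e. rank(t) ≤ rank(s).

open import Defs
open import Data.Nat using (ℕ; suc; _≤_; z≤n; s≤s)
open import Data.Nat.Properties
  using (≤-trans; ≤-reflexive; ⊔-lub; m≤m⊔n; m≤n⊔m; n≤1+n; 1+n≢n; ⊔-identityʳ)
open import Data.Fin using (Fin; toℕ; zero; suc; _≟_)
open import Data.Fin.Properties using (toℕ-injective)
open import Data.Vec using (Vec; []; _∷_; lookup; _[_]≔_; tabulate)
open import Data.Vec.Properties using (lookup∘update; lookup∘update′; lookup∘tabulate; []≔-lookup)
open import Data.List using ([]; _∷_; _++_)
open import Data.List.Relation.Unary.Any as Any using ()
open import Data.List.Membership.Propositional using (_∈_)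
open import Data.List.Membership.Propositional.Properties using (∈-++⁺ˡ; ∈-++⁺ʳ; ∈-++⁻)
open import Data.List.Relation.Binary.Pointwise using (Pointwise; []; _∷_)
open import Data.Product using (Σ; _×_; _,_; proj₁; proj₂)
open import Data.Sum using (_⊎_; inj₁; inj₂)
open import Data.Unit using (⊤; tt)
open import Data.Empty using (⊥-elim)
open import Relation.Binary.PropositionalEquality using (_≡_; _≢_; refl; sym; trans; cong; cong₂; subst; subst₂)
open import Relation.Nullary using (yes; no)

-- Prefixes of contexts; a structural description of ⊑ and of least upper bounds.

module Prefixes (S : Signature) where
  open Signature S

  𝒞 : Set
  𝒞 = Ctx S

  data Prefix (P : 𝒞 → Set) : 𝒞 → 𝒞 → Set where
    p-hole : ∀ {t} → P t → Prefix P □ t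
    p-var  : ∀ {x} → Prefix P (var x) (var x)
    p-fun  : ∀ {f As ts} → (∀ i → Prefix P (lookup As i) (lookup ts i)) →
             Prefix P (fun f As) (fun f ts)

  _≼_ : 𝒞 → 𝒞 → Set
  _≼_ = Prefix (λ _ → ⊤)

  prefix-map : ∀ {P Q : 𝒞 → Set} → (∀ {c} → P c → Q c) → ∀ {A t} → Prefix P A t → Prefix Q A t
  prefix-map g (p-hole p) = p-hole (g p)
  prefix-map g p-var = p-var
  prefix-map g (p-fun h) = p-fun λ i → prefix-map g (h i)

  prefix-≼ : ∀ {P A t} → Prefix P A t → A ≼ t
  prefix-≼ = prefix-map λ _ → tt

  hole-filler : ∀ {P c} → Prefix P □ c → P c
  hole-filler (p-hole p) = p

  mutual
    ≼-refl : ∀ A → A ≼ A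
    ≼-refl □ = p-hole tt
    ≼-refl (var x) = p-var
    ≼-refl (fun f As) = p-fun (≼-reflᵛ As)

    ≼-reflᵛ : ∀ {n} (As : Vec 𝒞 n) i → lookup As i ≼ lookup As i
    ≼-reflᵛ (A ∷ As) zero = ≼-refl A
    ≼-reflᵛ (A ∷ As) (suc i) = ≼-reflᵛ As i

  ≼-trans : ∀ {A B D} → A ≼ B → B ≼ D → A ≼ D
  ≼-trans (p-hole _) _ = p-hole tt
  ≼-trans p-var p-var = p-var
  ≼-trans (p-fun h) (p-fun g) = p-fun λ i → ≼-trans (h i) (g i)

  update-pointwise : ∀ {n} {Q : 𝒞 → 𝒞 → Set} (As Bs : Vec 𝒞 n) i {D E} → Q D E →
                     (∀ j → j ≢ i → Q (lookup As j) (lookup Bs j)) →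
                     ∀ j → Q (lookup (As [ i ]≔ D) j) (lookup (Bs [ i ]≔ E) j)
  update-pointwise {Q = Q} As Bs i {D} {E} q h j with j ≟ i
  ... | yes refl = subst₂ Q (sym (lookup∘update j As D)) (sym (lookup∘update j Bs E)) q
  ... | no j≢i = subst₂ Q (sym (lookup∘update′ j≢i As D)) (sym (lookup∘update′ j≢i Bs E)) (h j j≢i)

  update-right : ∀ {n} {Q : 𝒞 → 𝒞 → Set} (As Bs : Vec 𝒞 n) i {E} → Q (lookup As i) E →
                 (∀ j → Q (lookup As j) (lookup Bs j)) → ∀ j → Q (lookup As j) (lookup (Bs [ i ]≔ E) j)
  update-right {Q = Q} As Bs i {E} q h =
    subst (λ As′ → ∀ j → Q (lookup As′ j) (lookup (Bs [ i ]≔ E) j)) ([]≔-lookup As i)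
          (update-pointwise {Q = Q} As Bs i q (λ j _ → h j))

  -- ⊑ and ≼ coincide; ≼ is the form that can be analysed by pattern matching.
  ⊑→≼ : ∀ {A B} → _⊑_ S A B → A ≼ B
  ⊑→≼ ⊑-hole = p-hole tt
  ⊑→≼ ⊑-refl = ≼-refl _
  ⊑→≼ (⊑-trans a b) = ≼-trans (⊑→≼ a) (⊑→≼ b)
  ⊑→≼ (⊑-mono {ts = As} i a) = p-fun (update-right {Q = _≼_} As As i (⊑→≼ a) (≼-reflᵛ As))

  ⊑-vec : ∀ {n} (h : Vec 𝒞 n → 𝒞) →
          (∀ As i D → _⊑_ S (lookup As i) D → _⊑_ S (h As) (h (As [ i ]≔ D))) →
          ∀ As Bs → (∀ i → _⊑_ S (lookup As i) (lookup Bs i)) → _⊑_ S (h As) (h Bs)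
  ⊑-vec h mono [] [] _ = ⊑-refl
  ⊑-vec h mono (A ∷ As) (B ∷ Bs) le =
    ⊑-trans (mono (A ∷ As) zero B (le zero))
            (⊑-vec (λ Ds → h (B ∷ Ds)) (λ Ds i → mono (B ∷ Ds) (suc i)) As Bs (λ i → le (suc i)))

  ≼→⊑ : ∀ {A B} → A ≼ B → _⊑_ S A B
  ≼→⊑ (p-hole _) = ⊑-hole
  ≼→⊑ p-var = ⊑-refl
  ≼→⊑ {fun f As} {fun f Bs} (p-fun h) = ⊑-vec (fun f) (λ _ i _ → ⊑-mono i) As Bs (λ i → ≼→⊑ (h i))

  Join : 𝒞 → 𝒞 → 𝒞 → Set
  Join A B t = Σ 𝒞 λ E → A ≼ E × B ≼ E × E ≼ t × (∀ U → A ≼ U → B ≼ U → E ≼ U)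

  ≼-join : ∀ {A B t} → A ≼ t → B ≼ t → Join A B t
  ≼-join {B = B} (p-hole _) b = B , p-hole tt , ≼-refl B , b , λ _ _ u → u
  ≼-join {A = A} a (p-hole _) = A , ≼-refl A , p-hole tt , a , λ _ u _ → u
  ≼-join p-var p-var = var _ , p-var , p-var , p-var , λ _ u _ → u
  ≼-join {fun f As} {fun f Bs} {fun f ts} (p-fun a) (p-fun b) =
    fun f Es , p-fun (λ i → subst (lookup As i ≼_) (sym (Es-i i)) (proj₁ (proj₂ (J i))))
             , p-fun (λ i → subst (lookup Bs i ≼_) (sym (Es-i i)) (proj₁ (proj₂ (proj₂ (J i)))))
             , p-fun (λ i → subst (_≼ lookup ts i) (sym (Es-i i)) (proj₁ (proj₂ (proj₂ (proj₂ (J i))))))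
             , least
    where
    J : ∀ i → Join (lookup As i) (lookup Bs i) (lookup ts i)
    J i = ≼-join (a i) (b i)
    Es : Vec 𝒞 (arity f)
    Es = tabulate (λ i → proj₁ (J i))
    Es-i : ∀ i → lookup Es i ≡ proj₁ (J i)
    Es-i = lookup∘tabulate (λ i → proj₁ (J i))
    least : ∀ U → fun f As ≼ U → fun f Bs ≼ U → fun f Es ≼ U
    least (fun f Us) (p-fun a′) (p-fun b′) =
      p-fun λ i → subst (_≼ lookup Us i) (sym (Es-i i)) (proj₂ (proj₂ (proj₂ (proj₂ (J i)))) _ (a′ i) (b′ i))

  join-isLub : ∀ {A B t} ((E , a , b , _ , least) : Join A B t) → IsLub S A B E
  join-isLub (E , a , b , _ , least) = ≼→⊑ a , ≼→⊑ b , λ U x y → ≼→⊑ (least U (⊑→≼ x) (⊑→≼ y))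

-- Subterms, replacement and substitution, stated for prefix relations.

module Positions (S : Signature) where
  open Signature S
  open Prefixes S

  Sub : 𝒞 → Position → 𝒞 → Set
  Sub = Subterm S

  Rep : 𝒞 → Position → 𝒞 → 𝒞 → Set
  Rep = Replace S

  subterm-fun : ∀ {f As k p D} → Sub (fun f As) (k ∷ p) D →
                Σ (Fin (arity f)) λ i → toℕ i ≡ k × Sub (lookup As i) p D
  subterm-fun (there i s) = i , refl , s

  subterm-unique : ∀ {A p B B′} → Sub A p B → Sub A p B′ → B ≡ B′
  subterm-unique here here = refl
  subterm-unique (there i s) s′ with subterm-fun s′
  ... | j , eq , s″ with toℕ-injective eq
  ... | refl = subterm-unique s s″

  subterm-++ : ∀ {A p B q D} → Sub A p B → Sub B q D → Sub A (p ++ q) D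
  subterm-++ here s = s
  subterm-++ (there i s) s′ = there i (subterm-++ s s′)

  subterm-isTerm : ∀ {s p v} → IsTerm S s → Sub s p v → IsTerm S v
  subterm-isTerm ts sp (q , h) = ts (_ , subterm-++ sp h)

  prefix-at : ∀ {P A t q A′ t′} → Prefix P A t → Sub A q A′ → Sub t q t′ → Prefix P A′ t′
  prefix-at h here here = h
  prefix-at (p-fun h) (there i a) b with subterm-fun b
  ... | j , eq , b′ with toℕ-injective eq
  ... | refl = prefix-at (h i) a b′

  replace-exists : ∀ {A p B} → Sub A p B → ∀ E → Σ 𝒞 (Rep A p E)
  replace-exists here E = E , here
  replace-exists (there i s) E = _ , there i (proj₂ (replace-exists s E))

  replace-subterm : ∀ {A p E A′} → Rep A p E A′ → Sub A′ p E
  replace-subterm here = here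
  replace-subterm (there {ts = As} {E = E} i r) =
    there i (subst (λ X → Sub X _ _) (sym (lookup∘update i As E)) (replace-subterm r))

  replace-self : ∀ {A p B} → Sub A p B → Rep A p B A
  replace-self here = here
  replace-self (there {f = f} {ts = As} i s) =
    subst (Rep _ _ _) (cong (fun f) ([]≔-lookup As i)) (there i (replace-self s))

  replace-fun : ∀ {f As k p E B} → Rep (fun f As) (k ∷ p) E B →
                Σ (Fin (arity f)) λ i → toℕ i ≡ k × Σ 𝒞 λ E′ → Rep (lookup As i) p E E′ × B ≡ fun f (As [ i ]≔ E′)
  replace-fun (there i r) = i , refl , _ , r , refl

  prefix-replace : ∀ {P A t o E F A′ t′} → Prefix P A t → Rep A o E A′ → Rep t o F t′ →
                   Prefix P E F → Prefix P A′ t′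
  prefix-replace h here here e = e
  prefix-replace {P} {fun f As} {fun f ts} (p-fun h) (there i r) r′ e with replace-fun r′
  ... | j , eq , _ , r″ , refl with toℕ-injective eq
  ... | refl = p-fun (update-pointwise {Q = Prefix P} As ts i (prefix-replace (h i) r r″ e) (λ j _ → h j))

  replace-split : ∀ p₁ {s p₂ Y t v} → Rep s (p₁ ++ p₂) Y t → Sub s p₁ v →
                  Σ 𝒞 λ v′ → Rep v p₂ Y v′ × Rep s p₁ v′ t
  replace-split [] r here = _ , r , here
  replace-split (k ∷ p₁) (there i r) s with subterm-fun s
  ... | j , eq , s′ with toℕ-injective eq
  ... | refl with replace-split p₁ r s′
  ... | v′ , a , b = v′ , a , there i b

  refine : ∀ {P A B t} → A ≼ B → B ≼ t →
           (∀ q c D → Sub A q □ → Sub t q c → Sub B q D → Prefix P D c) → Prefix P B t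
  refine (p-hole _) _ k = k [] _ _ here here here
  refine p-var p-var k = p-var
  refine (p-fun h) (p-fun g) k =
    p-fun λ i → refine (h i) (g i) (λ q c D a b d → k (toℕ i ∷ q) c D (there i a) (there i b) (there i d))

  IsFun : 𝒞 → Set
  IsFun X = Σ Sym λ g → Σ (Vec 𝒞 (arity g)) λ Xs → X ≡ fun g Xs

  locate : ∀ {P M t p X} → Prefix P M t → Sub t p X → IsFun X →
           (Σ Position λ p₁ → Σ Position λ p₂ → Σ 𝒞 λ v →
              p ≡ p₁ ++ p₂ × Sub M p₁ □ × Sub t p₁ v × P v × Sub v p₂ X)
           ⊎ PosF S M p
  locate (p-hole pv) s _ = inj₁ ([] , _ , _ , refl , here , here , pv , s)
  locate p-var here (_ , _ , ())
  locate (p-fun h) here _ = inj₂ (_ , _ , here)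
  locate (p-fun h) (there i s) isF with locate (h i) s isF
  ... | inj₁ (p₁ , p₂ , v , refl , a , b , c , d) = inj₁ (toℕ i ∷ p₁ , p₂ , v , refl , there i a , there i b , c , d)
  ... | inj₂ (g , Xs , a) = inj₂ (g , Xs , there i a)

  _⟪_⟫ : 𝒞 → (ℕ → 𝒞) → 𝒞
  _⟪_⟫ = _⟨_⟩ S

  lookup-substV : ∀ {n} (As : Vec 𝒞 n) σ i → lookup (substV S As σ) i ≡ lookup As i ⟪ σ ⟫
  lookup-substV (A ∷ As) σ zero = refl
  lookup-substV (A ∷ As) σ (suc i) = lookup-substV As σ i

  subterm-subst : ∀ {ℓ q x σ} → Sub ℓ q (var x) → Sub (ℓ ⟪ σ ⟫) q (σ x)
  subterm-subst here = here
  subterm-subst {σ = σ} (there {ts = As} i s) =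
    there i (subst (λ X → Sub X _ _) (sym (lookup-substV As σ i)) (subterm-subst s))

  mutual
    prefix-subst : ∀ {P σ′ σ} r → IsTerm S r → (∀ x → _∈Vars_ S x r → Prefix P (σ′ x) (σ x)) →
                   Prefix P (r ⟪ σ′ ⟫) (r ⟪ σ ⟫)
    prefix-subst □ tr _ = ⊥-elim (tr ([] , here))
    prefix-subst (var x) tr h = h x ([] , here)
    prefix-subst (fun f As) tr h =
      p-fun (prefix-substᵛ As (λ i → subterm-isTerm tr (there i here))
                              (λ i x (q , s) → h x (toℕ i ∷ q , there i s)))

    prefix-substᵛ : ∀ {P σ′ σ n} (As : Vec 𝒞 n) → (∀ i → IsTerm S (lookup As i)) →
                    (∀ i x → _∈Vars_ S x (lookup As i) → Prefix P (σ′ x) (σ x)) →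
                    ∀ i → Prefix P (lookup (substV S As σ′) i) (lookup (substV S As σ) i)
    prefix-substᵛ (A ∷ As) ht hv zero = prefix-subst A (ht zero) (hv zero)
    prefix-substᵛ (A ∷ As) ht hv (suc i) = prefix-substᵛ As (λ i → ht (suc i)) (λ i → hv (suc i)) i

  prefix-binding : ∀ {P ℓ σ′ σ x} → Prefix P (ℓ ⟪ σ′ ⟫) (ℓ ⟪ σ ⟫) → _∈Vars_ S x ℓ → Prefix P (σ′ x) (σ x)
  prefix-binding h (q , s) = prefix-at h (subterm-subst s) (subterm-subst s)

  lhs-isFun : ∀ {ℓ} σ → IsTerm S ℓ → (∀ x → ℓ ≢ var x) → IsFun (ℓ ⟪ σ ⟫)
  lhs-isFun {□} σ tℓ _ = ⊥-elim (tℓ ([] , here))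
  lhs-isFun {var x} σ _ nv = ⊥-elim (nv x refl)
  lhs-isFun {fun g As} σ _ _ = g , substV S As σ , refl

-- Max-tops, aliens and rank for a context family satisfying (L3).

module Layers (S : Signature) (𝕃 : Ctx S → Set) (l3 : L3 S 𝕃) where
  open Signature S
  open Prefixes S
  open Positions S

  HR : 𝒞 → ℕ → Set
  HR = HasRank S 𝕃

  maxTop-layer : ∀ {M t} → IsMaxTop S 𝕃 M t → 𝕃 M
  maxTop-layer ((l , _) , _) = l

  maxTop-≼ : ∀ {M t} → IsMaxTop S 𝕃 M t → M ≼ t
  maxTop-≼ ((_ , le) , _) = ⊑→≼ le

  data Framed (D w : 𝒞) : Set where
    framed : ∀ {N t o} → IsMaxTop S 𝕃 N t → Sub t o w → Sub N o D → Framed D w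

  framed-self : ∀ {M t} → IsMaxTop S 𝕃 M t → Framed M t
  framed-self mt = framed mt here here

  framed-≼ : ∀ {D w} → Framed D w → D ≼ w
  framed-≼ (framed mt to No) = prefix-at (maxTop-≼ mt) No to

  framed-sub : ∀ {D w q c D′} → Framed D w → Sub w q c → Sub D q D′ → Framed D′ c
  framed-sub (framed mt to No) wc DD′ = framed mt (subterm-++ to wc) (subterm-++ No DD′)

  -- Absorption: below a function symbol of a max-top N, any layer K fitting
  -- the term is already covered by N (join N|o with K via L3, then use the
  -- maximality of N).
  absorb : ∀ {f Cs w K} → Framed (fun f Cs) w → 𝕃 K → K ≼ w → K ≼ fun f Cs
  absorb {f} {Cs} {K = K} (framed {N} {o = o} mt@((lN , _) , maximal) to No) lK K≼w =
    subst (K ≼_) E≡D K≼E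
    where
    N≼t = maxTop-≼ mt
    J = ≼-join (prefix-at N≼t No to) K≼w
    E = proj₁ J
    D≼E = proj₁ (proj₂ J)
    K≼E = proj₁ (proj₂ (proj₂ J))
    E≼w = proj₁ (proj₂ (proj₂ (proj₂ J)))
    N′ = proj₁ (replace-exists No E)
    rep = proj₂ (replace-exists No E)
    N′-layer : 𝕃 N′
    N′-layer = l3 N K o (fun f Cs) E N′ lN lK (f , Cs , No) No (join-isLub J) rep
    N′≡N : N′ ≡ N
    N′≡N = maximal N′ (N′-layer , ≼→⊑ (prefix-replace N≼t rep (replace-self to) E≼w))
                      (≼→⊑ (prefix-replace (≼-refl N) (replace-self No) rep D≼E))
    E≡D : E ≡ fun f Cs
    E≡D = subterm-unique (subst (λ X → Sub X o E) N′≡N (replace-subterm rep)) No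

  maxTop-unique : ∀ {M₁ M₂ t} → IsMaxTop S 𝕃 M₁ t → IsMaxTop S 𝕃 M₂ t → M₁ ≡ M₂
  maxTop-unique {M₁} {M₂} mt₁@(top₁ , max₁) mt₂@(top₂ , max₂) = compare (maxTop-≼ mt₁) (maxTop-≼ mt₂)
    where
    compare : M₁ ≼ _ → M₂ ≼ _ → M₁ ≡ M₂
    compare (p-hole _) _ = sym (max₁ M₂ top₂ ⊑-hole)
    compare _ (p-hole _) = max₂ M₁ top₁ ⊑-hole
    compare p-var p-var = refl
    compare (p-fun _) M₂≼t = max₂ M₁ top₁ (≼→⊑ (absorb (framed-self mt₁) (maxTop-layer mt₂) M₂≼t))

  mutual
    fill-prefix : ∀ {M us t} → Fill S 𝕃 M us t → Prefix (_∈ us) M t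
    fill-prefix hole = p-hole (Any.here refl)
    fill-prefix var = p-var
    fill-prefix (fun fv) = p-fun (fill-prefixᵛ fv)

    fill-prefixᵛ : ∀ {n} {Ms : Vec 𝒞 n} {us ts} → FillV S 𝕃 Ms us ts →
                   ∀ i → Prefix (_∈ us) (lookup Ms i) (lookup ts i)
    fill-prefixᵛ (f ∷ fv) zero = prefix-map ∈-++⁺ˡ (fill-prefix f)
    fill-prefixᵛ (f ∷ fv) (suc i) = prefix-map (∈-++⁺ʳ _) (fill-prefixᵛ fv i)

  mutual
    fill-all : ∀ {Q : 𝒞 → Set} {M us t} → Fill S 𝕃 M us t → Prefix Q M t → ∀ {u} → u ∈ us → Q u
    fill-all hole (p-hole q) (Any.here refl) = q
    fill-all (fun fv) (p-fun h) m = fill-allᵛ fv h m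

    fill-allᵛ : ∀ {Q : 𝒞 → Set} {n} {Ms : Vec 𝒞 n} {us ts} → FillV S 𝕃 Ms us ts →
                (∀ i → Prefix Q (lookup Ms i) (lookup ts i)) → ∀ {u} → u ∈ us → Q u
    fill-allᵛ (_∷_ {us = us} f fv) h m with ∈-++⁻ us m
    ... | inj₁ m′ = fill-all f (h zero) m′
    ... | inj₂ m′ = fill-allᵛ fv (λ i → h (suc i)) m′

  mutual
    fill-unique : ∀ {M us us′ t} → Fill S 𝕃 M us t → Fill S 𝕃 M us′ t → us ≡ us′
    fill-unique hole hole = refl
    fill-unique var var = refl
    fill-unique (fun a) (fun b) = fill-uniqueᵛ a b

    fill-uniqueᵛ : ∀ {n} {Ms : Vec 𝒞 n} {us us′ ts} → FillV S 𝕃 Ms us ts → FillV S 𝕃 Ms us′ ts → us ≡ us′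
    fill-uniqueᵛ [] [] = refl
    fill-uniqueᵛ (a ∷ as) (b ∷ bs) = cong₂ _++_ (fill-unique a b) (fill-uniqueᵛ as bs)

  mutual
    rank-unique : ∀ {t n n′} → HR t n → HR t n′ → n ≡ n′
    rank-unique (rank mt f pw) (rank mt′ f′ pw′) with maxTop-unique mt mt′
    ... | refl with fill-unique f f′
    ... | refl = cong suc (cong (maxList S 𝕃) (ranks-unique pw pw′))

    ranks-unique : ∀ {us ns ns′} → Pointwise HR us ns → Pointwise HR us ns′ → ns ≡ ns′
    ranks-unique [] [] = refl
    ranks-unique (a ∷ as) (b ∷ bs) = cong₂ _∷_ (rank-unique a b) (ranks-unique as bs)

  RankAtMost : ℕ → 𝒞 → Set
  RankAtMost k v = ∀ j → HR v j → j ≤ k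

  rankAtMost-≤ : ∀ {j k v} → RankAtMost j v → j ≤ k → RankAtMost k v
  rankAtMost-≤ r j≤k i hi = ≤-trans (r i hi) j≤k

  Bounded : ℕ → 𝒞 → 𝒞 → Set
  Bounded k = Prefix (RankAtMost k)

  bounded-≤ : ∀ {j k D w} → Bounded j D w → j ≤ k → Bounded k D w
  bounded-≤ b j≤k = prefix-map (λ r → rankAtMost-≤ r j≤k) b

  Descends : ℕ → 𝒞 → Set
  Descends k t = ∀ {D} → Framed D t → IsFun D → Bounded k D t

  -- Wherever c occurs below a max-top, the max-top leaves in c only aliens
  -- of rank ≤ k (for D = □ this says rank(c) ≤ k).
  Stable : ℕ → 𝒞 → Set
  Stable k c = ∀ {D} → Framed D c → Bounded k D c

  stable-≤ : ∀ {j k c} → Stable j c → j ≤ k → Stable k c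
  stable-≤ s j≤k fr = bounded-≤ (s fr) j≤k

  stable-intro : ∀ {k c} → RankAtMost k c → Descends k c → Stable k c
  stable-intro r d {□} fr = p-hole r
  stable-intro r d {var x} fr with framed-≼ fr
  ... | p-var = p-var
  stable-intro r d {fun f Cs} fr = d fr (f , Cs , refl)

  stable-layer : ∀ {k K t} → 𝕃 K → Prefix (Stable k) K t → Descends k t
  stable-layer lK Kt fr (f , Cs , refl) =
    refine (absorb fr lK (prefix-≼ Kt)) (framed-≼ fr)
           λ q c D′ Kq tq Dq → hole-filler (prefix-at Kt Kq tq) (framed-sub fr tq Dq)

  rank-bound : ∀ {k t} → Descends k t → RankAtMost (suc k) t
  rank-bound d n hr@(rank mt hole (r ∷ [])) =
    ⊥-elim (1+n≢n (trans (cong suc (sym (⊔-identityʳ _))) (rank-unique hr r)))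
  rank-bound d n (rank mt var []) = s≤s z≤n
  rank-bound d n (rank {M = fun f Ms} mt (fun fv) pw) =
    s≤s (aliens-bound pw (fill-all (fun fv) (d (framed-self mt) (f , Ms , refl))))
    where
    aliens-bound : ∀ {us ns k} → Pointwise HR us ns → (∀ {u} → u ∈ us → RankAtMost k u) → maxList S 𝕃 ns ≤ k
    aliens-bound [] _ = z≤n
    aliens-bound (r ∷ pw) h = ⊔-lub (h (Any.here refl) _ r) (aliens-bound pw (λ m → h (Any.there m)))

  mutual
    rank-stable : ∀ {w k} → HR w k → Stable k w
    rank-stable hw@(rank mt f pw) =
      stable-intro (λ j hj → ≤-reflexive (rank-unique hj hw)) descends
      where
      descends : Descends _ _
      descends fr isF =
        bounded-≤ (stable-layer (maxTop-layer mt) (prefix-map (aliens-stable pw) (fill-prefix f)) fr isF) (n≤1+n _)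

    aliens-stable : ∀ {us ns} → Pointwise HR us ns → ∀ {u} → u ∈ us → Stable (maxList S 𝕃 ns) u
    aliens-stable (r ∷ _) (Any.here refl) = stable-≤ (rank-stable r) (m≤m⊔n _ _)
    aliens-stable (_ ∷ pw) (Any.there m) = stable-≤ (aliens-stable pw m) (m≤n⊔m _ _)

-- One rewrite step of a weakly layered TRS.

module Descent (S : Signature) (𝕃 : Ctx S → Set) (l3 : L3 S 𝕃) (R : Ctx S → Ctx S → Set)
               (trs : IsTRS S R) (wl : WeaklyLayered S 𝕃 R) where
  open Prefixes S
  open Positions S
  open Layers S 𝕃 l3

  -- If s = M[us] with aliens of ranks ns and s → t, then t has a layer
  -- whose holes are filled by aliens of s or by a rewritten alien, all
  -- stable for max ns.
  mutual
    step-descends : ∀ {s t M us ns} → IsMaxTop S 𝕃 M s → Fill S 𝕃 M us s → Pointwise HR us ns →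
                    IsTerm S s → Rewrites S R s t → Descends (maxList S 𝕃 ns) t
    step-descends {s} {t} {M} {us} {ns} mt f pw ts (p , ℓ , r , ℓ→r , σ , atℓ , atr)
      with trs ℓ r ℓ→r
    ... | tℓ , tr , ℓ-nonvar , vars-r
      with locate (fill-prefix f) atℓ (lhs-isFun σ tℓ ℓ-nonvar)
    -- the redex lies inside the alien v, which rewrites to v′ in place
    ... | inj₁ (p₁ , p₂ , v , refl , M-hole , at-v , v∈us , v-atℓ) =
      stable-layer (maxTop-layer mt) (prefix-map filler-stable M≺t)
      where
      v′ = proj₁ (replace-split p₁ atr at-v)
      v-atr = proj₁ (proj₂ (replace-split p₁ atr at-v))
      s-atv′ = proj₂ (proj₂ (replace-split p₁ atr at-v))
      M≺t : Prefix (λ c → c ∈ us ⊎ c ≡ v′) M t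
      M≺t = prefix-replace (prefix-map inj₁ (fill-prefix f)) (replace-self M-hole) s-atv′ (p-hole (inj₂ refl))
      filler-stable : ∀ {c} → c ∈ us ⊎ c ≡ v′ → Stable (maxList S 𝕃 ns) c
      filler-stable (inj₁ m) = aliens-stable pw m
      filler-stable (inj₂ refl) =
        aliens-step pw v∈us (subterm-isTerm ts at-v) (p₂ , ℓ , r , ℓ→r , σ , v-atℓ , v-atr)
    -- the redex lies in M, which by (W) rewrites to a layer L over the aliens
    ... | inj₂ posF
      with wl ℓ r ℓ→r s M p t ts mt posF (σ , atℓ , atr)
    ... | L , L-layer , σ′ , M-atℓ , M-atr =
      stable-layer L-layer (prefix-map (aliens-stable pw) L≺t)
      where
      M≺s = fill-prefix f
      L≺t : Prefix (_∈ us) L t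
      L≺t = prefix-replace M≺s M-atr atr
              (prefix-subst r tr (λ x x∈r → prefix-binding (prefix-at M≺s M-atℓ atℓ) (vars-r x x∈r)))

    -- Induction hypothesis for the aliens: a rewritten alien of rank ≤ max ns
    -- is stable for max ns.
    aliens-step : ∀ {us ns} → Pointwise HR us ns → ∀ {u t} → u ∈ us → IsTerm S u →
                  Rewrites S R u t → Stable (maxList S 𝕃 ns) t
    aliens-step {ns = _ ∷ rest} (rank {ns = ns} mt f pw ∷ _) {t = t} (Any.here refl) tu step =
      stable-≤ (stable-intro (rank-bound d) (λ fr isF → bounded-≤ (d fr isF) (n≤1+n _)))
               (m≤m⊔n _ (maxList S 𝕃 rest))
      where
      d : Descends (maxList S 𝕃 ns) t
      d = step-descends mt f pw tu step
    aliens-step (_ ∷ pw) (Any.there m) tu step = stable-≤ (aliens-step pw m tu step) (m≤n⊔m _ _)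

-- With s = M[aliens of ranks ns], t descends to max ns, so rank(t) ≤ 1 + max ns = rank(s).
lemma3p13 : (S : Signature) (𝕃 : Ctx S → Set) (R : Ctx S → Ctx S → Set) →
            IsTRS S R → IsLayerSystem S 𝕃 → WeaklyLayered S 𝕃 R →
            ∀ s t → IsTerm S s → IsTerm S t → Rewrites S R s t →
            ∀ m n → HasRank S 𝕃 s m → HasRank S 𝕃 t n → n ≤ m
lemma3p13 S 𝕃 R trs (_ , _ , l3) wl _ _ s-term _ step _ n (rank mt f pw) ht =
  rank-bound (step-descends mt f pw s-term step) n ht
  where open Layers S 𝕃 l3
        open Descent S 𝕃 l3 R trs wl
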